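{- Let $e_0$ be an expression. If both the signature $\Sigma$ and the set $X$ of variables are finite, then $(N(\emptyset,\mathrm{Exp}(X)),\{e_0\leq 0\})$ reduces to $(N(\emptyset,\mathrm{Exp}(X)),\emptyset)$.
   Context: Here $E=\emptyset$, so atoms are terms (finite ordered trees labelled by $\Sigma$ and $X$) and $[\![e]\!]_\emptyset$ is the standard language interpretation of an expression as a set of trees. $\mathrm{Exp}(X)$ is the set of all closed expressions (variables, symbols of $\Sigma$, $0$, $+$, arbitrary least fixpoints $\mu x.e$). $N(\emptyset,\mathrm{Exp}(X))$ is the naive axiomatisation: semilattice axioms for $+,0$; strictness and distributivity over $+$ of each symbol of $\Sigma$ in each argument; and fixpoint unfolding $e[\mu x.e/x]\leq\mu x.e$ and induction $e[f/x]\leq f\rightarrow\mu x.e\leq f$; by Ésik it is complete for the empty set of hypotheses. For a set $H$ of hypotheses, $H^*(L)$ is the least language containing $L$ closed under: if $C[\![f]\!]\subseteq L$ for a context $C$ (a tree with one hole) and $(e\leq f)\in H$ then $C[\![e]\!]\subseteq L$. The representation $(Q,H)$ interprets $e$ as $H^*[\![e]\!]$ with equivalence $e\equiv f$ iff $Q,H\vdash e\leq f$ and $Q,H\vdash f\leq e$. $(Q,H)$ reduces to $(Q',H')$ if there are maps $r,i$ on expressions and $\iota$ from $H$-closed to $H'$-closed languages such that: $e'\equiv' f'$ implies $i(e')\equiv i(f')$; $i(r(e))\equiv e$; and $\iota(H^*[\![e]\!])=H'^*[\![r(e)]\!]$. -}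

module Defs where

open import Data.Nat using (ℕ; zero; suc)
open import Data.Fin using (Fin; zero; suc; _≟_)
open import Data.Product using (_×_; Σ; _,_)
open import Data.Empty using (⊥)
open import Relation.Nullary using (yes; no)
open import Relation.Binary.PropositionalEquality using (_≡_)
open import Level using (0ℓ)

module Syntax (nΣ : ℕ) (ar : Fin nΣ → ℕ) (nX : ℕ) where

  X : Set
  X = Fin nX

  -- μ-expressions with n bound (de Bruijn) variables in scope.
  -- Elements of X are free letters (atoms); bound variables are separate.
  data Exp (n : ℕ) : Set where
    bvar : Fin n → Exp n
    var  : X → Exp n
    app  : (f : Fin nΣ) → (Fin (ar f) → Exp n) → Exp n
    𝟘    : Exp n
    _⊕_  : Exp n → Exp n → Exp n
    μ    : Exp (suc n) → Exp n

  Exp₀ : Set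
  Exp₀ = Exp zero

  lift : ∀ {m n} → (Fin m → Fin n) → Fin (suc m) → Fin (suc n)
  lift ρ zero    = zero
  lift ρ (suc i) = suc (ρ i)

  rename : ∀ {m n} → (Fin m → Fin n) → Exp m → Exp n
  rename ρ (bvar i)  = bvar (ρ i)
  rename ρ (var x)   = var x
  rename ρ (app f es) = app f (λ i → rename ρ (es i))
  rename ρ 𝟘         = 𝟘
  rename ρ (a ⊕ b)   = rename ρ a ⊕ rename ρ b
  rename ρ (μ e)     = μ (rename (lift ρ) e)

  exts : ∀ {m n} → (Fin m → Exp n) → Fin (suc m) → Exp (suc n)
  exts σ zero    = bvar zero
  exts σ (suc i) = rename suc (σ i)

  subst : ∀ {m n} → (Fin m → Exp n) → Exp m → Exp n
  subst σ (bvar i)   = σ i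
  subst σ (var x)    = var x
  subst σ (app f es) = app f (λ i → subst σ (es i))
  subst σ 𝟘          = 𝟘
  subst σ (a ⊕ b)    = subst σ a ⊕ subst σ b
  subst σ (μ e)      = μ (subst (exts σ) e)

  single : Exp₀ → Fin 1 → Exp₀
  single f zero = f

  _[_] : Exp 1 → Exp₀ → Exp₀
  e [ f ] = subst (single f) e

  _[_≔_] : ∀ {k} → (Fin k → Exp₀) → Fin k → Exp₀ → Fin k → Exp₀
  (es [ i ≔ e ]) j with i ≟ j
  ... | yes _ = e
  ... | no  _ = es j

  data Tree : Set where
    leaf : X → Tree
    node : (f : Fin nΣ) → (Fin (ar f) → Tree) → Tree

  Lang : Set₁
  Lang = Tree → Set

  _≐_ : Lang → Lang → Set
  L ≐ K = ∀ t → (L t → K t) × (K t → L t)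

  data ⟦_⟧ : Exp₀ → Lang where
    var  : ∀ x → ⟦ var x ⟧ (leaf x)
    app  : ∀ f es ts → (∀ i → ⟦ es i ⟧ (ts i)) → ⟦ app f es ⟧ (node f ts)
    inl  : ∀ {a b t} → ⟦ a ⟧ t → ⟦ a ⊕ b ⟧ t
    inr  : ∀ {a b t} → ⟦ b ⟧ t → ⟦ a ⊕ b ⟧ t
    fold : ∀ {e t} → ⟦ e [ μ e ] ⟧ t → ⟦ μ e ⟧ t

  data Ctx : Set where
    hole : Ctx
    node : (f : Fin nΣ) → (i : Fin (ar f)) → (Fin (ar f) → Tree) → Ctx → Ctx

  plug : Ctx → Tree → Tree
  plug hole s = s
  plug (node f i ts C) s = node f λ j → aux (i ≟ j) j
    where
    aux : ∀ {p} {P : Set p} → Relation.Nullary.Dec P → Fin (ar f) → Tree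
    aux (yes _) j = plug C s
    aux (no _)  j = ts j

  Hyps : Set₁
  Hyps = Exp₀ → Exp₀ → Set

  noHyps : Hyps
  noHyps _ _ = ⊥

  only≤𝟘 : Exp₀ → Hyps
  only≤𝟘 e₀ e f = (e ≡ e₀) × (f ≡ 𝟘)

  Closed : Hyps → Lang → Set
  Closed H L = ∀ C e f → H e f → (∀ s → ⟦ f ⟧ s → L (plug C s))
                 → ∀ s → ⟦ e ⟧ s → L (plug C s)

  data _* (H : Hyps) (L : Lang) : Lang where
    base : ∀ {t} → L t → (H *) L t
    step : ∀ C e f → H e f → (∀ s → ⟦ f ⟧ s → (H *) L (plug C s))
             → ∀ s → ⟦ e ⟧ s → (H *) L (plug C s)

  *-closed : ∀ H L → Closed H ((H *) L)
  *-closed H L = step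

  -- N(∅, Exp(X)) together with hypotheses H: equational logic on closed
  -- expressions, with  e ≤ f  abbreviating  e ⊕ f = f.

  data _⊢_≈_ (H : Hyps) : Exp₀ → Exp₀ → Set where
    refl  : ∀ {a} → H ⊢ a ≈ a
    sym   : ∀ {a b} → H ⊢ a ≈ b → H ⊢ b ≈ a
    trans : ∀ {a b c} → H ⊢ a ≈ b → H ⊢ b ≈ c → H ⊢ a ≈ c
    ⊕-cong : ∀ {a a' b b'} → H ⊢ a ≈ a' → H ⊢ b ≈ b' → H ⊢ (a ⊕ b) ≈ (a' ⊕ b')
    app-cong : ∀ f {es es'} → (∀ i → H ⊢ es i ≈ es' i) → H ⊢ app f es ≈ app f es'
    ⊕-assoc : ∀ a b c → H ⊢ ((a ⊕ b) ⊕ c) ≈ (a ⊕ (b ⊕ c))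
    ⊕-comm  : ∀ a b → H ⊢ (a ⊕ b) ≈ (b ⊕ a)
    ⊕-idem  : ∀ a → H ⊢ (a ⊕ a) ≈ a
    ⊕-unit  : ∀ a → H ⊢ (a ⊕ 𝟘) ≈ a
    strict  : ∀ f es i → H ⊢ app f (es [ i ≔ 𝟘 ]) ≈ 𝟘
    distr   : ∀ f es i a b → H ⊢ app f (es [ i ≔ a ⊕ b ])
                                 ≈ (app f (es [ i ≔ a ]) ⊕ app f (es [ i ≔ b ]))
    unfold  : ∀ e → H ⊢ ((e [ μ e ]) ⊕ μ e) ≈ μ e
    induct  : ∀ e f → H ⊢ ((e [ f ]) ⊕ f) ≈ f → H ⊢ (μ e ⊕ f) ≈ f
    hyp     : ∀ {e f} → H e f → H ⊢ (e ⊕ f) ≈ f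

  _⊢_≤_ : Hyps → Exp₀ → Exp₀ → Set
  H ⊢ e ≤ f = H ⊢ (e ⊕ f) ≈ f

  _⊢_≡_ : Hyps → Exp₀ → Exp₀ → Set
  H ⊢ e ≡ f = (H ⊢ e ≤ f) × (H ⊢ f ≤ e)

  record Reduces (H H' : Hyps) : Set₁ where
    field
      r  : Exp₀ → Exp₀
      i  : Exp₀ → Exp₀
      -- ι : H-closed languages → H'-closed languages (a function on sets,
      -- hence invariant under extensional equality of languages)
      ι  : (L : Lang) → Closed H L → Lang
      ι-closed : ∀ L c → Closed H' (ι L c)
      ι-ext : ∀ L K c d → L ≐ K → ι L c ≐ ι K d
      i-sound : ∀ e f → H' ⊢ e ≡ f → H ⊢ i e ≡ i f
      i∘r : ∀ e → H ⊢ i (r e) ≡ e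
      ι-sem : ∀ e → ι ((H *) ⟦ e ⟧) (*-closed H ⟦ e ⟧) ≐ (H' *) ⟦ r e ⟧

-- Let T be the μ-expression  μx. e₀ + Σ_f Σ_i f(⊤,…,x,…,⊤)  (x in the i-th argument, ⊤ an
-- expression for all trees), so that ⟦ T ⟧ = { C[s] ∣ s ∈ ⟦ e₀ ⟧ }, the contextual closure of
-- ⟦ e₀ ⟧. Then H*⟦ e ⟧ = ⟦ e + T ⟧ for H = {e₀ ≤ 0}, so r(e) = e + T, i = id and ι = id
-- (up to pointwise equality of trees) work:
-- from e₀ ≤ 0, strictness and fixpoint induction H proves T = 0, hence e + T ≡ e.
module Submission where

open import Defs
open import Data.Nat using (ℕ; zero; suc)
open import Data.Fin using (Fin; zero; suc; _≟_)
open import Data.Product using (Σ; _×_; _,_; proj₁; proj₂)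
open import Data.Empty using (⊥-elim)
open import Relation.Nullary using (Dec; yes; no)
open import Relation.Binary.PropositionalEquality using (_≡_; refl; cong)

module _ {nΣ : ℕ} {ar : Fin nΣ → ℕ} {nX : ℕ} where
  open Syntax nΣ ar nX

  -- Syntactic equality with argument families compared pointwise (≡ would need funext).
  data _≅_ {n : ℕ} : Exp n → Exp n → Set where
    bvar : ∀ i → bvar i ≅ bvar i
    var  : ∀ x → var x ≅ var x
    app  : ∀ f {es es'} → (∀ i → es i ≅ es' i) → app f es ≅ app f es'
    𝟘    : 𝟘 ≅ 𝟘
    _⊕_  : ∀ {a a' b b'} → a ≅ a' → b ≅ b' → (a ⊕ b) ≅ (a' ⊕ b')
    μ    : ∀ {e e'} → e ≅ e' → μ e ≅ μ e'

  ≅-refl : ∀ {n} (e : Exp n) → e ≅ e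
  ≅-refl (bvar i)   = bvar i
  ≅-refl (var x)    = var x
  ≅-refl (app f es) = app f (λ i → ≅-refl (es i))
  ≅-refl 𝟘          = 𝟘
  ≅-refl (a ⊕ b)    = ≅-refl a ⊕ ≅-refl b
  ≅-refl (μ e)      = μ (≅-refl e)

  ≅-sym : ∀ {n} {a b : Exp n} → a ≅ b → b ≅ a
  ≅-sym (bvar i)  = bvar i
  ≅-sym (var x)   = var x
  ≅-sym (app f p) = app f (λ i → ≅-sym (p i))
  ≅-sym 𝟘         = 𝟘
  ≅-sym (p ⊕ q)   = ≅-sym p ⊕ ≅-sym q
  ≅-sym (μ p)     = μ (≅-sym p)

  ≅-trans : ∀ {n} {a b c : Exp n} → a ≅ b → b ≅ c → a ≅ c
  ≅-trans (bvar i)  q          = q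
  ≅-trans (var x)   q          = q
  ≅-trans (app f p) (app .f q) = app f (λ i → ≅-trans (p i) (q i))
  ≅-trans 𝟘         q          = q
  ≅-trans (p ⊕ p')  (q ⊕ q')   = ≅-trans p q ⊕ ≅-trans p' q'
  ≅-trans (μ p)     (μ q)      = μ (≅-trans p q)

  rename-cong : ∀ {m n} (ρ : Fin m → Fin n) {e e' : Exp m} → e ≅ e' → rename ρ e ≅ rename ρ e'
  rename-cong ρ (bvar i)  = bvar (ρ i)
  rename-cong ρ (var x)   = var x
  rename-cong ρ (app f p) = app f (λ i → rename-cong ρ (p i))
  rename-cong ρ 𝟘         = 𝟘
  rename-cong ρ (p ⊕ q)   = rename-cong ρ p ⊕ rename-cong ρ q
  rename-cong ρ (μ p)     = μ (rename-cong (lift ρ) p)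

  exts-cong : ∀ {m n} {σ σ' : Fin m → Exp n} → (∀ i → σ i ≅ σ' i) → ∀ i → exts σ i ≅ exts σ' i
  exts-cong p zero    = bvar zero
  exts-cong p (suc i) = rename-cong suc (p i)

  subst-cong : ∀ {m n} {σ σ' : Fin m → Exp n} → (∀ i → σ i ≅ σ' i)
             → ∀ {e e'} → e ≅ e' → subst σ e ≅ subst σ' e'
  subst-cong q (bvar i)  = q i
  subst-cong q (var x)   = var x
  subst-cong q (app f p) = app f (λ i → subst-cong q (p i))
  subst-cong q 𝟘         = 𝟘
  subst-cong q (p ⊕ p')  = subst-cong q p ⊕ subst-cong q p'
  subst-cong q (μ p)     = μ (subst-cong (exts-cong q) p)

  subst-rename : ∀ {k m n} (σ : Fin m → Exp n) (ρ : Fin k → Fin m) (e : Exp k)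
               → subst σ (rename ρ e) ≅ subst (λ i → σ (ρ i)) e
  subst-rename σ ρ (bvar i)   = ≅-refl (σ (ρ i))
  subst-rename σ ρ (var x)    = var x
  subst-rename σ ρ (app f es) = app f (λ i → subst-rename σ ρ (es i))
  subst-rename σ ρ 𝟘          = 𝟘
  subst-rename σ ρ (a ⊕ b)    = subst-rename σ ρ a ⊕ subst-rename σ ρ b
  subst-rename σ ρ (μ e)      =
    μ (≅-trans (subst-rename (exts σ) (lift ρ) e) (subst-cong exts-lift (≅-refl e)))
    where
    exts-lift : ∀ i → exts σ (lift ρ i) ≅ exts (λ j → σ (ρ j)) i
    exts-lift zero    = bvar zero
    exts-lift (suc i) = ≅-refl _

  subst-id : ∀ {n} (σ : Fin n → Exp n) → (∀ i → σ i ≅ bvar i) → (e : Exp n) → subst σ e ≅ e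
  subst-id σ q (bvar i)   = q i
  subst-id σ q (var x)    = var x
  subst-id σ q (app f es) = app f (λ i → subst-id σ q (es i))
  subst-id σ q 𝟘          = 𝟘
  subst-id σ q (a ⊕ b)    = subst-id σ q a ⊕ subst-id σ q b
  subst-id σ q (μ e)      = μ (subst-id (exts σ) exts-id e)
    where
    exts-id : ∀ i → exts σ i ≅ bvar i
    exts-id zero    = bvar zero
    exts-id (suc i) = rename-cong suc (q i)

  weaken : Exp₀ → Exp 1
  weaken = rename (λ ())

  weaken-[] : ∀ (M e : Exp₀) → (weaken e [ M ]) ≅ e
  weaken-[] M e = ≅-trans (subst-rename (single M) (λ ()) e) (subst-id _ (λ ()) e)

  ⟦⟧-resp-≅ : ∀ {e e' t} → ⟦ e ⟧ t → e ≅ e' → ⟦ e' ⟧ t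
  ⟦⟧-resp-≅ (var x)         (var .x)  = var x
  ⟦⟧-resp-≅ (app f es ts p) (app .f q) = app f _ ts (λ i → ⟦⟧-resp-≅ (p i) (q i))
  ⟦⟧-resp-≅ (inl p)         (q ⊕ _)   = inl (⟦⟧-resp-≅ p q)
  ⟦⟧-resp-≅ (inr p)         (_ ⊕ q)   = inr (⟦⟧-resp-≅ p q)
  ⟦⟧-resp-≅ (fold {e} p)    (μ {e' = e'} q) = fold (⟦⟧-resp-≅ p (subst-cong unfolded q))
    where
    unfolded : ∀ i → single (μ e) i ≅ single (μ e') i
    unfolded zero = μ q

  ⊢-mono : ∀ {G G' : Hyps} → (∀ {e f} → G e f → G' e f) → ∀ {a b} → G ⊢ a ≈ b → G' ⊢ a ≈ b
  ⊢-mono G⊆G' refl               = refl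
  ⊢-mono G⊆G' (sym p)            = sym (⊢-mono G⊆G' p)
  ⊢-mono G⊆G' (trans p q)        = trans (⊢-mono G⊆G' p) (⊢-mono G⊆G' q)
  ⊢-mono G⊆G' (⊕-cong p q)       = ⊕-cong (⊢-mono G⊆G' p) (⊢-mono G⊆G' q)
  ⊢-mono G⊆G' (app-cong f p)     = app-cong f (λ i → ⊢-mono G⊆G' (p i))
  ⊢-mono G⊆G' (⊕-assoc a b c)    = ⊕-assoc a b c
  ⊢-mono G⊆G' (⊕-comm a b)       = ⊕-comm a b
  ⊢-mono G⊆G' (⊕-idem a)         = ⊕-idem a
  ⊢-mono G⊆G' (⊕-unit a)         = ⊕-unit a
  ⊢-mono G⊆G' (strict f es i)    = strict f es i
  ⊢-mono G⊆G' (distr f es i a b) = distr f es i a b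
  ⊢-mono G⊆G' (unfold e)         = unfold e
  ⊢-mono G⊆G' (induct e f p)     = induct e f (⊢-mono G⊆G' p)
  ⊢-mono G⊆G' (hyp h)            = hyp (G⊆G' h)

  ≡⇒⊢≈ : ∀ {G : Hyps} {a b} → a ≡ b → G ⊢ a ≈ b
  ≡⇒⊢≈ refl = refl

  ≈⇒≤ : ∀ {G : Hyps} {a b} → G ⊢ a ≈ b → G ⊢ a ≤ b
  ≈⇒≤ {b = b} p = trans (⊕-cong p refl) (⊕-idem b)

  ≈⇒≡ : ∀ {G : Hyps} {a b} → G ⊢ a ≈ b → G ⊢ a ≡ b
  ≈⇒≡ p = ≈⇒≤ p , ≈⇒≤ (sym p)

  ≈-[≔] : ∀ {G : Hyps} {k} (es : Fin k → Exp₀) {i a} → G ⊢ es i ≈ a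
        → ∀ j → G ⊢ es j ≈ (es [ i ≔ a ]) j
  ≈-[≔] es {i} esᵢ≈a j with i ≟ j
  ... | yes refl = esᵢ≈a
  ... | no _     = refl

  ≤-antisym : ∀ {G : Hyps} {a b} → G ⊢ a ≤ b → G ⊢ b ≤ a → G ⊢ a ≈ b
  ≤-antisym {a = a} {b} a≤b b≤a = trans (sym b≤a) (trans (⊕-comm b a) a≤b)

  ⊕-identityʳ-≈𝟘 : ∀ {G : Hyps} {a b} → G ⊢ b ≈ 𝟘 → G ⊢ (a ⊕ b) ≈ a
  ⊕-identityʳ-≈𝟘 {a = a} b≈𝟘 = trans (⊕-cong refl b≈𝟘) (⊕-unit a)

  μ-cong : ∀ {G : Hyps} {a b} → (∀ M → G ⊢ (a [ M ]) ≈ (b [ M ])) → G ⊢ μ a ≈ μ b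
  μ-cong {a = a} {b} a≈b = ≤-antisym
    (induct a (μ b) (trans (⊕-cong (a≈b (μ b)) refl) (unfold b)))
    (induct b (μ a) (trans (⊕-cong (sym (a≈b (μ a))) refl) (unfold a)))

  -- A closing substitution presented as a chain, so that under μ it can be extended by [ M ].
  data Substs : ℕ → ℕ → Set where
    []  : ∀ {k} → Substs k k
    _▹_ : ∀ {k j l} → Substs k j → (Fin j → Exp l) → Substs k l

  applySubsts : ∀ {k j} → Substs k j → Exp k → Exp j
  applySubsts []      e = e
  applySubsts (c ▹ σ) e = subst σ (applySubsts c e)

  extsSubsts : ∀ {k j} → Substs k j → Substs (suc k) (suc j)
  extsSubsts []      = []
  extsSubsts (c ▹ σ) = extsSubsts c ▹ exts σ

  applySubsts-μ : ∀ {k j} (c : Substs k j) e → applySubsts c (μ e) ≡ μ (applySubsts (extsSubsts c) e)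
  applySubsts-μ []      e = refl
  applySubsts-μ (c ▹ σ) e = cong (subst σ) (applySubsts-μ c e)

  applySubsts-app : ∀ {k j} (c : Substs k j) f es
                  → applySubsts c (app f es) ≡ app f (λ i → applySubsts c (es i))
  applySubsts-app []      f es = refl
  applySubsts-app (c ▹ σ) f es = cong (subst σ) (applySubsts-app c f es)

  applySubsts-⊕ : ∀ {k j} (c : Substs k j) a b
                → applySubsts c (a ⊕ b) ≡ (applySubsts c a ⊕ applySubsts c b)
  applySubsts-⊕ []      a b = refl
  applySubsts-⊕ (c ▹ σ) a b = cong (subst σ) (applySubsts-⊕ c a b)

  ≅⇒⊢≈-applySubsts : ∀ {G : Hyps} {n} {a b : Exp n} → a ≅ b → (c : Substs n 0)
                   → G ⊢ applySubsts c a ≈ applySubsts c b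
  ≅⇒⊢≈-applySubsts (bvar i) c = refl
  ≅⇒⊢≈-applySubsts (var x)  c = refl
  ≅⇒⊢≈-applySubsts 𝟘        c = refl
  ≅⇒⊢≈-applySubsts (app f {es} {es'} p) c =
    trans (≡⇒⊢≈ (applySubsts-app c f es))
      (trans (app-cong f (λ i → ≅⇒⊢≈-applySubsts (p i) c))
             (sym (≡⇒⊢≈ (applySubsts-app c f es'))))
  ≅⇒⊢≈-applySubsts (_⊕_ {a} {a'} {b} {b'} p q) c =
    trans (≡⇒⊢≈ (applySubsts-⊕ c a b))
      (trans (⊕-cong (≅⇒⊢≈-applySubsts p c) (≅⇒⊢≈-applySubsts q c))
             (sym (≡⇒⊢≈ (applySubsts-⊕ c a' b'))))
  ≅⇒⊢≈-applySubsts (μ {e} {e'} p) c =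
    trans (≡⇒⊢≈ (applySubsts-μ c e))
      (trans (μ-cong (λ M → ≅⇒⊢≈-applySubsts p (extsSubsts c ▹ single M)))
             (sym (≡⇒⊢≈ (applySubsts-μ c e'))))

  ≅⇒⊢≈ : ∀ {G : Hyps} {a b : Exp₀} → a ≅ b → G ⊢ a ≈ b
  ≅⇒⊢≈ p = ≅⇒⊢≈-applySubsts p []

  ⨁ : ∀ {n} k → (Fin k → Exp n) → Exp n
  ⨁ zero    g = 𝟘
  ⨁ (suc k) g = g zero ⊕ ⨁ k (λ j → g (suc j))

  ⟦⨁⟧-intro : ∀ {m} (σ : Fin m → Exp₀) k (g : Fin k → Exp m) j {t}
            → ⟦ subst σ (g j) ⟧ t → ⟦ subst σ (⨁ k g) ⟧ t
  ⟦⨁⟧-intro σ (suc k) g zero    p = inl p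
  ⟦⨁⟧-intro σ (suc k) g (suc j) p = inr (⟦⨁⟧-intro σ k (λ j → g (suc j)) j p)

  ⟦⨁⟧-elim : ∀ {m} (σ : Fin m → Exp₀) k (g : Fin k → Exp m) {t}
           → ⟦ subst σ (⨁ k g) ⟧ t → Σ (Fin k) λ j → ⟦ subst σ (g j) ⟧ t
  ⟦⨁⟧-elim σ (suc k) g (inl p) = zero , p
  ⟦⨁⟧-elim σ (suc k) g (inr p) with ⟦⨁⟧-elim σ k (λ j → g (suc j)) p
  ... | j , q = suc j , q

  ⨁≈𝟘 : ∀ {G : Hyps} {m} (σ : Fin m → Exp₀) k (g : Fin k → Exp m)
      → (∀ j → G ⊢ subst σ (g j) ≈ 𝟘) → G ⊢ subst σ (⨁ k g) ≈ 𝟘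
  ⨁≈𝟘 σ zero    g p = refl
  ⨁≈𝟘 σ (suc k) g p =
    trans (⊕-cong (p zero) (⨁≈𝟘 σ k (λ j → g (suc j)) (λ j → p (suc j)))) (⊕-unit 𝟘)

  universalBody : Exp 1
  universalBody = ⨁ nX var ⊕ ⨁ nΣ (λ f → app f (λ _ → bvar zero))

  universal : Exp₀
  universal = μ universalBody

  ⟦universal⟧ : ∀ t → ⟦ universal ⟧ t
  ⟦universal⟧ (leaf x)    = fold (inl (⟦⨁⟧-intro (single universal) nX var x (var x)))
  ⟦universal⟧ (node f ts) =
    fold (inr (⟦⨁⟧-intro (single universal) nΣ (λ f → app f (λ _ → bvar zero)) f
                (app f _ ts (λ i → ⟦universal⟧ (ts i)))))

  data _≈ₜ_ : Tree → Tree → Set where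
    leaf : ∀ x → leaf x ≈ₜ leaf x
    node : ∀ f {us vs} → (∀ j → us j ≈ₜ vs j) → node f us ≈ₜ node f vs

  ≈ₜ-refl : ∀ t → t ≈ₜ t
  ≈ₜ-refl (leaf x)    = leaf x
  ≈ₜ-refl (node f ts) = node f (λ j → ≈ₜ-refl (ts j))

  ⟦⟧-resp-≈ₜ : ∀ {e t u} → ⟦ e ⟧ t → t ≈ₜ u → ⟦ e ⟧ u
  ⟦⟧-resp-≈ₜ (var x)         (leaf .x)  = var x
  ⟦⟧-resp-≈ₜ (app f es ts p) (node .f q) = app f es _ (λ i → ⟦⟧-resp-≈ₜ (p i) (q i))
  ⟦⟧-resp-≈ₜ (inl p)         q          = inl (⟦⟧-resp-≈ₜ p q)
  ⟦⟧-resp-≈ₜ (inr p)         q          = inr (⟦⟧-resp-≈ₜ p q)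
  ⟦⟧-resp-≈ₜ (fold p)        q          = fold (⟦⟧-resp-≈ₜ p q)

  data IsNode (f : Fin nΣ) : Tree → Set where
    isNode : ∀ us → IsNode f (node f us)

  child : ∀ {f} (j : Fin (ar f)) (t : Tree) → IsNode f t → Tree
  child j .(node _ us) (isNode us) = us j

  -- The j-th child of a plugged node is computed by a case split on i ≟ j inside plug;
  -- a motive over that Dec lets the caller split on the same test.
  plug-child-elim : ∀ f i ts C s j (P : Dec (i ≡ j) → Tree → Set)
                  → (∀ i≡j → P (yes i≡j) (plug C s)) → (∀ i≢j → P (no i≢j) (ts j))
                  → P (i ≟ j) (child j (plug (node f i ts C) s) (isNode _))
  plug-child-elim f i ts C s j P atHole elsewhere with i ≟ j
  ... | yes i≡j = atHole i≡j
  ... | no  i≢j = elsewhere i≢j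

  -- Trees identified only up to ≈ₜ, since plug does not produce ≡-equal trees.
  saturate : Lang → Lang
  saturate L t = Σ Tree λ t' → L t' × (t' ≈ₜ t)

  saturate-resp-≐ : ∀ {L K} → L ≐ K → saturate L ≐ saturate K
  saturate-resp-≐ L≐K t =
    (λ { (t' , l , q) → t' , proj₁ (L≐K t') l , q }) ,
    (λ { (t' , k , q) → t' , proj₂ (L≐K t') k , q })

  noHyps*-base : ∀ {L t} → (noHyps *) L t → L t
  noHyps*-base (base p) = p

  noHyps-closed : ∀ L → Closed noHyps L
  noHyps-closed L C e f ()

  module ContextualClosure (e₀ : Exp₀) where

    holeOrUniversal : ∀ {p} {P : Set p} → Dec P → Exp 1
    holeOrUniversal (yes _) = bvar zero
    holeOrUniversal (no _)  = weaken universal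

    holeAt : ∀ f → Fin (ar f) → Exp 1
    holeAt f i = app f (λ j → holeOrUniversal (i ≟ j))

    closureBody : Exp 1
    closureBody = weaken e₀ ⊕ ⨁ nΣ (λ f → ⨁ (ar f) (holeAt f))

    closure : Exp₀
    closure = μ closureBody

    InClosure : Lang
    InClosure t = Σ Ctx λ C → Σ Tree λ s → (plug C s ≈ₜ t) × ⟦ e₀ ⟧ s

    private
      σ : Fin 1 → Exp₀
      σ = single closure

    ⟦closure⟧-intro : ∀ C s → ⟦ e₀ ⟧ s → ⟦ closure ⟧ (plug C s)
    ⟦closure⟧-intro hole s p = fold (inl (⟦⟧-resp-≅ p (≅-sym (weaken-[] closure e₀))))
    ⟦closure⟧-intro (node f i ts C) s p =
      fold (inr (⟦⨁⟧-intro σ nΣ _ f (⟦⨁⟧-intro σ (ar f) (holeAt f) i (app f _ _ children))))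
      where
      children : ∀ j → ⟦ subst σ (holeOrUniversal (i ≟ j)) ⟧ (child j (plug (node f i ts C) s) (isNode _))
      children j = plug-child-elim f i ts C s j (λ d u → ⟦ subst σ (holeOrUniversal d) ⟧ u)
        (λ _ → ⟦closure⟧-intro C s p)
        (λ _ → ⟦⟧-resp-≅ (⟦universal⟧ (ts j)) (≅-sym (weaken-[] closure universal)))

    ⟦holeAt⟧-hole : ∀ {f} (i : Fin (ar f)) {u} → ⟦ subst σ (holeOrUniversal (i ≟ i)) ⟧ u
                  → ⟦ closure ⟧ u
    ⟦holeAt⟧-hole i with i ≟ i
    ... | yes _ = λ p → p
    ... | no i≢i = ⊥-elim (i≢i refl)

    ⟦closure⟧-elim : ∀ t → ⟦ closure ⟧ t → InClosure t
    ⟦holeAt⟧-elim : ∀ f i t → ⟦ subst σ (holeAt f i) ⟧ t → InClosure t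

    ⟦closure⟧-elim t (fold (inl p)) = hole , t , ≈ₜ-refl t , ⟦⟧-resp-≅ p (weaken-[] closure e₀)
    ⟦closure⟧-elim t (fold (inr p)) with ⟦⨁⟧-elim σ nΣ _ p
    ... | f , q with ⟦⨁⟧-elim σ (ar f) (holeAt f) q
    ... | i , r = ⟦holeAt⟧-elim f i t r

    ⟦holeAt⟧-elim f i (node .f ts) (app .f _ .ts p) with ⟦closure⟧-elim (ts i) (⟦holeAt⟧-hole i (p i))
    ... | C , s , plugged , q =
      node f i ts C , s ,
      node f (λ j → plug-child-elim f i ts C s j (λ _ u → u ≈ₜ ts j)
                      (λ { refl → plugged }) (λ _ → ≈ₜ-refl (ts j))) ,
      q

    H : Hyps
    H = only≤𝟘 e₀

    H*⊆⟦⊕closure⟧ : ∀ e {t} → (H *) ⟦ e ⟧ t → ⟦ e ⊕ closure ⟧ t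
    H*⊆⟦⊕closure⟧ e (base p)                            = inl p
    H*⊆⟦⊕closure⟧ e (step C .e₀ .𝟘 (refl , refl) _ s p) = inr (⟦closure⟧-intro C s p)

    closure⊆H*⟦⟧ : ∀ e {t} → ⟦ closure ⟧ t → saturate ((H *) ⟦ e ⟧) t
    closure⊆H*⟦⟧ e {t} p with ⟦closure⟧-elim t p
    ... | C , s , plugged , q = plug C s , step C e₀ 𝟘 (refl , refl) (λ _ ()) s q , plugged

    e₀≈𝟘 : H ⊢ e₀ ≈ 𝟘
    e₀≈𝟘 = trans (sym (⊕-unit e₀)) (hyp (refl , refl))

    -- Every holeAt term has a 𝟘 argument, so closureBody [ 𝟘 ] ≈ 𝟘 by strictness.
    closure≈𝟘 : H ⊢ closure ≈ 𝟘
    closure≈𝟘 = trans (sym (⊕-unit closure)) (induct closureBody 𝟘 (≈⇒≤ body≈𝟘))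
      where
      σ₀ : Fin 1 → Exp₀
      σ₀ = single 𝟘

      hole≈𝟘 : ∀ {f} (i : Fin (ar f)) → H ⊢ subst σ₀ (holeOrUniversal (i ≟ i)) ≈ 𝟘
      hole≈𝟘 i with i ≟ i
      ... | yes _  = refl
      ... | no i≢i = ⊥-elim (i≢i refl)

      holeAt≈𝟘 : ∀ f i → H ⊢ subst σ₀ (holeAt f i) ≈ 𝟘
      holeAt≈𝟘 f i = trans (app-cong f (≈-[≔] _ (hole≈𝟘 i))) (strict f _ i)

      body≈𝟘 : H ⊢ (closureBody [ 𝟘 ]) ≈ 𝟘
      body≈𝟘 = trans (⊕-cong (trans (≅⇒⊢≈ (weaken-[] 𝟘 e₀)) e₀≈𝟘)
                              (⨁≈𝟘 σ₀ nΣ _ (λ f → ⨁≈𝟘 σ₀ (ar f) (holeAt f) (holeAt≈𝟘 f))))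
                     (⊕-unit 𝟘)

    reduction : Reduces H noHyps
    reduction = record
      { r        = _⊕ closure
      ; i        = λ e → e
      ; ι        = λ L _ → saturate L
      ; ι-closed = λ L _ → noHyps-closed (saturate L)
      ; ι-ext    = λ L K _ _ → saturate-resp-≐
      ; i-sound  = λ e f (e≤f , f≤e) → ⊢-mono (λ ()) e≤f , ⊢-mono (λ ()) f≤e
      ; i∘r      = λ e → ≈⇒≡ (⊕-identityʳ-≈𝟘 closure≈𝟘)
      ; ι-sem    = λ e t → sound e t , complete e t
      }
      where
      sound : ∀ e t → saturate ((H *) ⟦ e ⟧) t → (noHyps *) ⟦ e ⊕ closure ⟧ t
      sound e t (t' , p , t'≈t) = base (⟦⟧-resp-≈ₜ (H*⊆⟦⊕closure⟧ e p) t'≈t)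

      complete : ∀ e t → (noHyps *) ⟦ e ⊕ closure ⟧ t → saturate ((H *) ⟦ e ⟧) t
      complete e t p with noHyps*-base p
      ... | inl q = t , base q , ≈ₜ-refl t
      ... | inr q = closure⊆H*⟦⟧ e q

lemma7p3 : (nΣ : ℕ) (ar : Fin nΣ → ℕ) (nX : ℕ) (e₀ : Syntax.Exp₀ nΣ ar nX)
    → Syntax.Reduces nΣ ar nX (Syntax.only≤𝟘 nΣ ar nX e₀) (Syntax.noHyps nΣ ar nX)
lemma7p3 nΣ ar nX e₀ = ContextualClosure.reduction e₀
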